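{- Let $n\geq 4$ and let $C=\operatorname{circ}(1,0,\ldots,0,1)$ be the circulant matrix of order $n-1$. Let \[M=\left[\begin{array}{c|c} \mathbf{1}^T & \mathbf{0}^T \\ \hline I_{n-1} & C \end{array}\right]\] (this is the vertex-edge incidence matrix of the wheel graph $W_n$ on $n$ vertices, with the hub as the first vertex, the spokes as the first $n-1$ edges and the rim edges as the last $n-1$ edges). Then $CC^T+I_{n-1}$ is invertible and the Moore–Penrose inverse of $M$ is \[M^+=\frac{1}{2(n-1)} \left[\begin{array}{r|c} 2\mathbf{1} & X \\ \hline -\mathbf{1} & Y \end{array}\right],\] where $X=2(CC^T+I_{n-1})^{ -1}\left[ (n-1)I_{n-1}-J_{n-1}\right]$ and $Y= J_{n-1}+C^TX$.
   Context: For real numbers $c_0,\ldots,c_{k-1}$, $\operatorname{circ}(c_0,c_1,\ldots,c_{k-1})$ denotes the $k\times k$ circulant matrix whose $(i,j)$-entry is $c_{(j-i)\bmod k}$ (first row $c_0,\ldots,c_{k-1}$, each subsequent row the cyclic right shift of the previous one). $\mathbf{1}$ and $\mathbf{0}$ denote the all-ones and all-zeros column vectors of length $n-1$, $I_k$ the $k\times k$ identity matrix and $J_k$ the $k\times k$ all-ones matrix. The wheel graph $W_n$ ($n\ge 4$) is obtained from a cycle on $n-1$ vertices by adding a vertex adjacent to all cycle vertices. The Moore–Penrose inverse of a real $m\times n$ matrix $A$ is the unique $n\times m$ real matrix $A^+$ with $AA^+A=A$, $A^+AA^+=A^+$, $(AA^+)^T=AA^+$, $(A^+A)^T=A^+A$.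 -}

module Defs where

open import Data.Nat as ℕ using (ℕ; zero; suc; _∸_)
open import Data.Nat.DivMod using (_%_; m%n<n)
open import Data.Fin using (Fin; zero; suc; toℕ; fromℕ<; splitAt)
open import Data.Sum using (_⊎_; inj₁; inj₂)
open import Data.Integer using (+_)
open import Data.Rational using (ℚ; 0ℚ; 1ℚ; _+_; _*_; -_; _/_)
open import Relation.Binary.PropositionalEquality using (_≡_)
open import Relation.Nullary using (yes; no)
open import Data.Product using (_×_)

infix 4 _≋_
infixl 7 _·_
infixl 6 _⊕_
infixr 8 _⊗_
infix 9 _ᵀ

-- Real (here: rational) matrices with m rows and n columns.
Matrix : ℕ → ℕ → Set
Matrix m n = Fin m → Fin n → ℚ

∑ : (n : ℕ) → (Fin n → ℚ) → ℚ
∑ zero    f = 0ℚ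
∑ (suc n) f = f zero + ∑ n (λ i → f (suc i))

_·_ : ∀ {m n p} → Matrix m n → Matrix n p → Matrix m p
_·_ {n = n} A B i j = ∑ n (λ l → A i l * B l j)

_ᵀ : ∀ {m n} → Matrix m n → Matrix n m
(A ᵀ) i j = A j i

_⊕_ : ∀ {m n} → Matrix m n → Matrix m n → Matrix m n
(A ⊕ B) i j = A i j + B i j

_⊗_ : ∀ {m n} → ℚ → Matrix m n → Matrix m n
(c ⊗ A) i j = c * A i j

_≋_ : ∀ {m n} → Matrix m n → Matrix m n → Set
A ≋ B = ∀ i j → A i j ≡ B i j

ℕtoℚ : ℕ → ℚ
ℕtoℚ n = + n / 1

Id : (k : ℕ) → Matrix k k
Id k i j with toℕ i ℕ.≟ toℕ j
... | yes _ = 1ℚ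
... | no  _ = 0ℚ

J : (k : ℕ) → Matrix k k
J k i j = 1ℚ

-- circ(c_0,...,c_{k-1}) : (i,j)-entry is c_{(j-i) mod k}.
circ : ∀ {k} → (Fin k → ℚ) → Matrix k k
circ {suc m} c i j =
  c (fromℕ< (m%n<n ((toℕ j ℕ.+ suc m) ∸ toℕ i) (suc m)))

firstLast : (k : ℕ) → Fin k → ℚ
firstLast k l with toℕ l ℕ.≟ 0 | toℕ l ℕ.≟ (k ∸ 1)
... | yes _ | _     = 1ℚ
... | no  _ | yes _ = 1ℚ
... | no  _ | no  _ = 0ℚ

Cmat : (k : ℕ) → Matrix k k
Cmat k = circ (firstLast k)

Mmat : (k : ℕ) → Matrix (suc k) (k ℕ.+ k)
Mmat k zero    j with splitAt k j
... | inj₁ _ = 1ℚ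
... | inj₂ _ = 0ℚ
Mmat k (suc i) j with splitAt k j
... | inj₁ a = Id k i a
... | inj₂ b = Cmat k i b

-- 1/(2k) (value for k = 0 irrelevant).
inv2k : ℕ → ℚ
inv2k zero    = 0ℚ
inv2k (suc m) = + 1 / (2 ℕ.* suc m)

-- Given Inv (meant to be (CCᵀ+I)⁻¹): X = 2·Inv·((k)I - J), Y = J + CᵀX.
Xmat : (k : ℕ) → Matrix k k → Matrix k k
Xmat k Inv = ℕtoℚ 2 ⊗ (Inv · ((ℕtoℚ k ⊗ Id k) ⊕ ((- 1ℚ) ⊗ J k)))

Ymat : (k : ℕ) → Matrix k k → Matrix k k
Ymat k Inv = J k ⊕ ((Cmat k ᵀ) · Xmat k Inv)

Pmat : (k : ℕ) → Matrix k k → Matrix (k ℕ.+ k) (suc k)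
Pmat k Inv = inv2k k ⊗ Q
  where
  Q : Matrix (k ℕ.+ k) (suc k)
  Q r zero with splitAt k r
  ... | inj₁ _ = ℕtoℚ 2
  ... | inj₂ _ = - 1ℚ
  Q r (suc i) with splitAt k r
  ... | inj₁ a = Xmat k Inv a i
  ... | inj₂ b = Ymat k Inv b i

IsMoorePenroseInverse : ∀ {m n} → Matrix m n → Matrix n m → Set
IsMoorePenroseInverse A P =
  ((A · P) · A ≋ A) × ((P · A) · P ≋ P) ×
  (((A · P) ᵀ) ≋ (A · P)) × (((P · A) ᵀ) ≋ (P · A))

{-# OPTIONS --safe #-}
-- C = I + S with S the cyclic shift, so A = CCᵀ + I = 3I + S + Sᵀ. Its inverse is the symmetric
-- circulant whose first row g solves g(d−1) + 3g(d) + g(d+1) = [d = 0] cyclically; the homogeneous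
-- recurrence is solved by the signed Fibonacci numbers (−1)^(d+1) F(2d), and the normalising constant
-- is nonzero because F(2d) grows. The rows of A sum to 5, so those of A⁻¹ sum to 1/5; hence the
-- columns of X sum to 0 and X + CY = 2(n−1)I, which by block multiplication gives MP = I. PM is
-- symmetric because X is, and a right inverse P of M with PM symmetric satisfies all four Penrose
-- equations.

module Submission where

open import Defs
open import Data.Nat using (ℕ; suc; _≤_)
open import Data.Product using (Σ; _×_)

open import Data.Empty using (⊥-elim)
open import Data.Fin as Fin using (Fin; toℕ; fromℕ<; fromℕ; _↑ˡ_; _↑ʳ_)
import Data.Fin.Properties as FinP
import Data.Integer as ℤ
import Data.Integer.Properties as ℤP
open import Data.Nat as ℕ using (zero; z≤n; s≤s; _<_; _∸_; _%_)
open import Data.Nat.Coprimality using (Coprime)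
open import Data.Nat.DivMod using (m%n<n; m<n⇒m%n≡m; m%n%n≡m%n; %-distribˡ-+; [m+n]%n≡m%n; n%n≡0)
open import Data.Nat.Divisibility using (∣1⇒≡1)
import Data.Nat.Properties as ℕP
open import Algebra.Properties.CommutativeSemigroup ℕP.+-commutativeSemigroup
  using () renaming (interchange to +-interchange)
open import Data.Product using (_,_; proj₂; ∃)
open import Data.Rational
  using (ℚ; 0ℚ; 1ℚ; _+_; _*_; -_; _-_; _/_; mkℚ; NonZero; 1/_; ≢-nonZero)
  renaming (_≤_ to _≤ℚ_)
import Data.Rational.Properties as ℚP
open import Data.Rational.Solver using (module +-*-Solver)
open import Data.Sum using (_⊎_; inj₁; inj₂)
open import Function using (_∘_; _⇔_; mk⇔; Equivalence)
open import Relation.Binary.PropositionalEquality hiding (J)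
open import Relation.Nullary using (yes; no)
open import Relation.Nullary.Decidable using (toWitness; toWitnessFalse)

open +-*-Solver

∑-cong : ∀ n {f g : Fin n → ℚ} → (∀ i → f i ≡ g i) → ∑ n f ≡ ∑ n g
∑-cong zero    eq = refl
∑-cong (suc n) eq = cong₂ _+_ (eq Fin.zero) (∑-cong n (eq ∘ Fin.suc))

∑-zero : ∀ n {f : Fin n → ℚ} → (∀ i → f i ≡ 0ℚ) → ∑ n f ≡ 0ℚ
∑-zero zero    eq = refl
∑-zero (suc n) eq = cong₂ _+_ (eq Fin.zero) (∑-zero n (eq ∘ Fin.suc))

∑-+ : ∀ n (f g : Fin n → ℚ) → ∑ n (λ i → f i + g i) ≡ ∑ n f + ∑ n g
∑-+ zero    f g = refl
∑-+ (suc n) f g = trans (cong (f Fin.zero + g Fin.zero +_) (∑-+ n (f ∘ Fin.suc) (g ∘ Fin.suc)))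
  (solve 4 (λ a b c d → (a :+ b) :+ (c :+ d) := (a :+ c) :+ (b :+ d)) refl
     (f Fin.zero) (g Fin.zero) (∑ n (f ∘ Fin.suc)) (∑ n (g ∘ Fin.suc)))

∑-*ˡ : ∀ n c (f : Fin n → ℚ) → ∑ n (λ i → c * f i) ≡ c * ∑ n f
∑-*ˡ zero    c f = sym (ℚP.*-zeroʳ c)
∑-*ˡ (suc n) c f = trans (cong (c * f Fin.zero +_) (∑-*ˡ n c (f ∘ Fin.suc)))
                         (sym (ℚP.*-distribˡ-+ c _ _))

∑-*ʳ : ∀ n c (f : Fin n → ℚ) → ∑ n (λ i → f i * c) ≡ ∑ n f * c
∑-*ʳ n c f = trans (∑-cong n (λ i → ℚP.*-comm (f i) c))
                   (trans (∑-*ˡ n c f) (ℚP.*-comm c (∑ n f)))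

∑-comm : ∀ m n (f : Fin m → Fin n → ℚ) →
  ∑ m (λ i → ∑ n (f i)) ≡ ∑ n (λ j → ∑ m (λ i → f i j))
∑-comm zero    n f = sym (∑-zero n (λ _ → refl))
∑-comm (suc m) n f = trans (cong (∑ n (f Fin.zero) +_) (∑-comm m n (f ∘ Fin.suc)))
                           (sym (∑-+ n (f Fin.zero) _))

∑-select : ∀ n (f : Fin n → ℚ) a → (∀ i → i ≢ a → f i ≡ 0ℚ) → ∑ n f ≡ f a
∑-select (suc n) f Fin.zero h =
  trans (cong (f Fin.zero +_) (∑-zero n (λ i → h (Fin.suc i) (λ ())))) (ℚP.+-identityʳ _)
∑-select (suc n) f (Fin.suc a) h =
  trans (cong₂ _+_ (h Fin.zero (λ ()))
          (∑-select n (f ∘ Fin.suc) a (λ i i≢a → h (Fin.suc i) (i≢a ∘ FinP.suc-injective))))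
        (ℚP.+-identityˡ _)

∑-↑ : ∀ m n (f : Fin (m ℕ.+ n) → ℚ) →
  ∑ (m ℕ.+ n) f ≡ ∑ m (λ a → f (a ↑ˡ n)) + ∑ n (λ b → f (m ↑ʳ b))
∑-↑ zero    n f = sym (ℚP.+-identityˡ _)
∑-↑ (suc m) n f = trans (cong (f Fin.zero +_) (∑-↑ m n (f ∘ Fin.suc)))
                        (sym (ℚP.+-assoc (f Fin.zero) _ _))

coprime-1 : ∀ n → Coprime n 1
coprime-1 n (_ , d∣1) = ∣1⇒≡1 d∣1

ℕtoℚ≡mkℚ : ∀ n → ℕtoℚ n ≡ mkℚ (ℤ.+ n) 0 (coprime-1 n)
ℕtoℚ≡mkℚ n = ℚP.normalize-coprime (coprime-1 n)

ℕtoℚ-suc : ∀ n → ℕtoℚ (suc n) ≡ 1ℚ + ℕtoℚ n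
ℕtoℚ-suc n rewrite ℕtoℚ≡mkℚ n | ℤP.*-identityʳ (ℤ.+ n) = refl

ℕtoℚ-+ : ∀ a b → ℕtoℚ (a ℕ.+ b) ≡ ℕtoℚ a + ℕtoℚ b
ℕtoℚ-+ zero    b = sym (ℚP.+-identityˡ _)
ℕtoℚ-+ (suc a) b = begin
  ℕtoℚ (suc a ℕ.+ b)          ≡⟨ ℕtoℚ-suc (a ℕ.+ b) ⟩
  1ℚ + ℕtoℚ (a ℕ.+ b)         ≡⟨ cong (1ℚ +_) (ℕtoℚ-+ a b) ⟩
  1ℚ + (ℕtoℚ a + ℕtoℚ b)      ≡⟨ sym (ℚP.+-assoc 1ℚ (ℕtoℚ a) (ℕtoℚ b)) ⟩
  1ℚ + ℕtoℚ a + ℕtoℚ b        ≡⟨ cong (_+ ℕtoℚ b) (sym (ℕtoℚ-suc a)) ⟩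
  ℕtoℚ (suc a) + ℕtoℚ b       ∎
  where open ≡-Reasoning

∑-const : ∀ n c → ∑ n (λ _ → c) ≡ ℕtoℚ n * c
∑-const zero    c = sym (ℚP.*-zeroˡ c)
∑-const (suc n) c = begin
  c + ∑ n (λ _ → c)        ≡⟨ cong (c +_) (∑-const n c) ⟩
  c + ℕtoℚ n * c           ≡⟨ solve 2 (λ c x → c :+ x :* c := (con 1ℚ :+ x) :* c) refl c (ℕtoℚ n) ⟩
  (1ℚ + ℕtoℚ n) * c        ≡⟨ cong (_* c) (sym (ℕtoℚ-suc n)) ⟩
  ℕtoℚ (suc n) * c         ∎
  where open ≡-Reasoning

Id-≡ : ∀ {n} (i j : Fin n) → toℕ i ≡ toℕ j → Id n i j ≡ 1ℚ
Id-≡ i j i≡j with toℕ i ℕ.≟ toℕ j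
... | yes _   = refl
... | no  i≢j = ⊥-elim (i≢j i≡j)

Id-≢ : ∀ {n} (i j : Fin n) → toℕ i ≢ toℕ j → Id n i j ≡ 0ℚ
Id-≢ i j i≢j with toℕ i ℕ.≟ toℕ j
... | yes i≡j = ⊥-elim (i≢j i≡j)
... | no  _   = refl

Id-cong-⇔ : ∀ {n n′} (i j : Fin n) (i′ j′ : Fin n′) →
  (toℕ i ≡ toℕ j ⇔ toℕ i′ ≡ toℕ j′) → Id n i j ≡ Id n′ i′ j′
Id-cong-⇔ i j i′ j′ i≡j⇔i′≡j′ with toℕ i ℕ.≟ toℕ j
... | yes i≡j = sym (Id-≡ i′ j′ (Equivalence.to i≡j⇔i′≡j′ i≡j))
... | no  i≢j = sym (Id-≢ i′ j′ (i≢j ∘ Equivalence.from i≡j⇔i′≡j′))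

Id-sym : ∀ n (i j : Fin n) → Id n i j ≡ Id n j i
Id-sym n i j = Id-cong-⇔ i j j i (mk⇔ sym sym)

Id-suc : ∀ n (i j : Fin n) → Id (suc n) (Fin.suc i) (Fin.suc j) ≡ Id n i j
Id-suc n i j = Id-cong-⇔ _ _ i j (mk⇔ ℕP.suc-injective (cong suc))

∑-Idˡ : ∀ n a (f : Fin n → ℚ) → ∑ n (λ l → Id n a l * f l) ≡ f a
∑-Idˡ n a f = begin
  ∑ n (λ l → Id n a l * f l)   ≡⟨ ∑-select n _ a off-diagonal ⟩
  Id n a a * f a               ≡⟨ cong (_* f a) (Id-≡ a a refl) ⟩
  1ℚ * f a                     ≡⟨ ℚP.*-identityˡ (f a) ⟩
  f a                          ∎
  where
  open ≡-Reasoning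
  off-diagonal : ∀ l → l ≢ a → Id n a l * f l ≡ 0ℚ
  off-diagonal l l≢a =
    trans (cong (_* f l) (Id-≢ a l (l≢a ∘ sym ∘ FinP.toℕ-injective))) (ℚP.*-zeroˡ (f l))

∑-Idʳ : ∀ n a (f : Fin n → ℚ) → ∑ n (λ l → f l * Id n l a) ≡ f a
∑-Idʳ n a f = trans (∑-cong n (λ l → trans (ℚP.*-comm (f l) _) (cong (_* f l) (Id-sym n l a))))
                    (∑-Idˡ n a f)

·-assoc : ∀ {m n p q} (A : Matrix m n) (B : Matrix n p) (C : Matrix p q) →
  (A · B) · C ≋ A · (B · C)
·-assoc {n = n} {p} A B C i j = begin
  ∑ p (λ l → ∑ n (λ t → A i t * B t l) * C l j)
    ≡⟨ ∑-cong p (λ l → sym (∑-*ʳ n (C l j) (λ t → A i t * B t l))) ⟩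
  ∑ p (λ l → ∑ n (λ t → A i t * B t l * C l j))
    ≡⟨ ∑-comm p n _ ⟩
  ∑ n (λ t → ∑ p (λ l → A i t * B t l * C l j))
    ≡⟨ ∑-cong n (λ t → trans (∑-cong p (λ l → ℚP.*-assoc (A i t) (B t l) (C l j)))
                             (∑-*ˡ p (A i t) (λ l → B t l * C l j))) ⟩
  ∑ n (λ t → A i t * ∑ p (λ l → B t l * C l j))
    ∎
  where open ≡-Reasoning

·-identityʳ : ∀ {m n} (A : Matrix m n) → A · Id n ≋ A
·-identityʳ {n = n} A i j = ∑-Idʳ n j (A i)

·-identityˡ : ∀ {m n} (A : Matrix m n) → Id m · A ≋ A
·-identityˡ {m} A i j = ∑-Idˡ m i (λ l → A l j)

·-congˡ : ∀ {m n p} {A B : Matrix m n} (C : Matrix n p) → A ≋ B → A · C ≋ B · C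
·-congˡ {n = n} C A≋B i j = ∑-cong n (λ l → cong (_* C l j) (A≋B i l))

·-congʳ : ∀ {m n p} (A : Matrix m n) {B C : Matrix n p} → B ≋ C → A · B ≋ A · C
·-congʳ {n = n} A B≋C i j = ∑-cong n (λ l → cong (A i l *_) (B≋C l j))

Symmetric : ∀ {n} → Matrix n n → Set
Symmetric A = A ᵀ ≋ A

symmetric-rightInverse⇒leftInverse : ∀ {n} {A V : Matrix n n} →
  Symmetric A → Symmetric V → A · V ≋ Id n → V · A ≋ Id n
symmetric-rightInverse⇒leftInverse {n} {A} {V} A-sym V-sym AV≋I i j = begin
  ∑ n (λ t → V i t * A t j)   ≡⟨ ∑-cong n (λ t → trans (cong₂ _*_ (sym (V-sym i t)) (sym (A-sym t j)))
                                                        (ℚP.*-comm (V t i) (A j t))) ⟩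
  ∑ n (λ t → A j t * V t i)   ≡⟨ AV≋I j i ⟩
  Id n j i                    ≡⟨ Id-sym n j i ⟩
  Id n i j                    ∎
  where open ≡-Reasoning

rightInverse⇒MoorePenrose : ∀ {m n} (A : Matrix m n) (P : Matrix n m) →
  A · P ≋ Id m → Symmetric (P · A) → IsMoorePenroseInverse A P
rightInverse⇒MoorePenrose {m} A P AP≋I PA-sym =
    (λ i j → trans (·-congˡ A AP≋I i j) (·-identityˡ A i j))
  , (λ i j → trans (·-assoc P A P i j) (trans (·-congʳ P AP≋I i j) (·-identityʳ P i j)))
  , (λ i j → trans (AP≋I j i) (trans (Id-sym m j i) (sym (AP≋I i j))))
  , PA-sym

leftInverse-rowSum : ∀ {n} (A V : Matrix n n) s → V · A ≋ Id n →
  (∀ t → ∑ n (A t) ≡ s) → ∀ i → ∑ n (V i) * s ≡ 1ℚ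
leftInverse-rowSum {n} A V s VA≋I rowSum i = begin
  ∑ n (V i) * s                                  ≡⟨ ∑-*ʳ n s (V i) ⟨
  ∑ n (λ t → V i t * s)                          ≡⟨ ∑-cong n (λ t → cong (V i t *_) (rowSum t)) ⟨
  ∑ n (λ t → V i t * ∑ n (A t))                  ≡⟨ ∑-cong n (λ t → ∑-*ˡ n (V i t) (A t)) ⟨
  ∑ n (λ t → ∑ n (λ l → V i t * A t l))          ≡⟨ ∑-comm n n _ ⟩
  ∑ n (λ l → (V · A) i l)                        ≡⟨ ∑-cong n (λ l → trans (VA≋I i l) (sym (ℚP.*-identityʳ _))) ⟩
  ∑ n (λ l → Id n i l * 1ℚ)                      ≡⟨ ∑-Idˡ n i (λ _ → 1ℚ) ⟩
  1ℚ                                             ∎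
  where open ≡-Reasoning

↑-cases : ∀ m n (r : Fin (m ℕ.+ n)) → (∃ λ a → r ≡ a ↑ˡ n) ⊎ (∃ λ b → r ≡ m ↑ʳ b)
↑-cases m n r with Fin.splitAt m r | FinP.join-splitAt m n r
... | inj₁ a | join≡r = inj₁ (a , sym join≡r)
... | inj₂ b | join≡r = inj₂ (b , sym join≡r)

[m%d+n]%d≡[m+n]%d : ∀ m n d .{{_ : ℕ.NonZero d}} → (m % d ℕ.+ n) % d ≡ (m ℕ.+ n) % d
[m%d+n]%d≡[m+n]%d m n d = begin
  (m % d ℕ.+ n) % d           ≡⟨ %-distribˡ-+ (m % d) n d ⟩
  (m % d % d ℕ.+ n % d) % d   ≡⟨ cong (λ x → (x ℕ.+ n % d) % d) (m%n%n≡m%n m d) ⟩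
  (m % d ℕ.+ n % d) % d       ≡⟨ %-distribˡ-+ m n d ⟨
  (m ℕ.+ n) % d               ∎
  where open ≡-Reasoning

[m+n%d]%d≡[m+n]%d : ∀ m n d .{{_ : ℕ.NonZero d}} → (m ℕ.+ n % d) % d ≡ (m ℕ.+ n) % d
[m+n%d]%d≡[m+n]%d m n d = begin
  (m ℕ.+ n % d) % d   ≡⟨ cong (_% d) (ℕP.+-comm m (n % d)) ⟩
  (n % d ℕ.+ m) % d   ≡⟨ [m%d+n]%d≡[m+n]%d n m d ⟩
  (n ℕ.+ m) % d       ≡⟨ cong (_% d) (ℕP.+-comm n m) ⟩
  (m ℕ.+ n) % d       ∎
  where open ≡-Reasoning

%-cancelʳ-+ : ∀ m n {o d} .{{_ : ℕ.NonZero d}} → o ≤ d →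
  (m ℕ.+ o) % d ≡ (n ℕ.+ o) % d → m % d ≡ n % d
%-cancelʳ-+ m n {o} {d} o≤d eq =
  trans (sym (add-complement m)) (trans (cong (λ x → (x ℕ.+ (d ∸ o)) % d) eq) (add-complement n))
  where
  open ≡-Reasoning
  add-complement : ∀ x → ((x ℕ.+ o) % d ℕ.+ (d ∸ o)) % d ≡ x % d
  add-complement x = begin
    ((x ℕ.+ o) % d ℕ.+ (d ∸ o)) % d   ≡⟨ [m%d+n]%d≡[m+n]%d (x ℕ.+ o) (d ∸ o) d ⟩
    (x ℕ.+ o ℕ.+ (d ∸ o)) % d         ≡⟨ cong (_% d) (ℕP.+-assoc x o (d ∸ o)) ⟩
    (x ℕ.+ (o ℕ.+ (d ∸ o))) % d       ≡⟨ cong (λ y → (x ℕ.+ y) % d) (ℕP.m+[n∸m]≡n o≤d) ⟩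
    (x ℕ.+ d) % d                     ≡⟨ [m+n]%n≡m%n x d ⟩
    x % d                             ∎

module Cyclic (m : ℕ) where

  k : ℕ
  k = suc m

  toℕ%k : ∀ (t : Fin k) → toℕ t % k ≡ toℕ t
  toℕ%k t = m<n⇒m%n≡m (FinP.toℕ<n t)

  shift unshift : Fin k → Fin k
  shift   t = fromℕ< (m%n<n (suc (toℕ t)) k)
  unshift t = fromℕ< (m%n<n (toℕ t ℕ.+ m) k)

  toℕ-shift : ∀ t → toℕ (shift t) ≡ suc (toℕ t) % k
  toℕ-shift t = FinP.toℕ-fromℕ< _

  toℕ-unshift : ∀ t → toℕ (unshift t) ≡ (toℕ t ℕ.+ m) % k
  toℕ-unshift t = FinP.toℕ-fromℕ< _

  shift-unshift : ∀ t → shift (unshift t) ≡ t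
  shift-unshift t = FinP.toℕ-injective (begin
    toℕ (shift (unshift t))            ≡⟨ toℕ-shift (unshift t) ⟩
    suc (toℕ (unshift t)) % k          ≡⟨ cong (λ x → suc x % k) (toℕ-unshift t) ⟩
    (1 ℕ.+ (toℕ t ℕ.+ m) % k) % k      ≡⟨ [m+n%d]%d≡[m+n]%d 1 (toℕ t ℕ.+ m) k ⟩
    suc (toℕ t ℕ.+ m) % k              ≡⟨ cong (_% k) (ℕP.+-suc (toℕ t) m) ⟨
    (toℕ t ℕ.+ k) % k                  ≡⟨ [m+n]%n≡m%n (toℕ t) k ⟩
    toℕ t % k                          ≡⟨ toℕ%k t ⟩
    toℕ t                              ∎)
    where open ≡-Reasoning

  unshift-shift : ∀ t → unshift (shift t) ≡ t
  unshift-shift t = FinP.toℕ-injective (begin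
    toℕ (unshift (shift t))            ≡⟨ toℕ-unshift (shift t) ⟩
    (toℕ (shift t) ℕ.+ m) % k          ≡⟨ cong (λ x → (x ℕ.+ m) % k) (toℕ-shift t) ⟩
    (suc (toℕ t) % k ℕ.+ m) % k        ≡⟨ [m%d+n]%d≡[m+n]%d (suc (toℕ t)) m k ⟩
    suc (toℕ t ℕ.+ m) % k              ≡⟨ cong (_% k) (ℕP.+-suc (toℕ t) m) ⟨
    (toℕ t ℕ.+ k) % k                  ≡⟨ [m+n]%n≡m%n (toℕ t) k ⟩
    toℕ t % k                          ≡⟨ toℕ%k t ⟩
    toℕ t                              ∎)
    where open ≡-Reasoning

  offset : Fin k → Fin k → ℕ
  offset i j = ((toℕ j ℕ.+ k) ∸ toℕ i) % k

  offset<k : ∀ i j → offset i j < k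
  offset<k i j = m%n<n ((toℕ j ℕ.+ k) ∸ toℕ i) k

  offset-+ : ∀ i j → (offset i j ℕ.+ toℕ i) % k ≡ toℕ j
  offset-+ i j = begin
    (((toℕ j ℕ.+ k) ∸ toℕ i) % k ℕ.+ toℕ i) % k   ≡⟨ [m%d+n]%d≡[m+n]%d ((toℕ j ℕ.+ k) ∸ toℕ i) (toℕ i) k ⟩
    ((toℕ j ℕ.+ k) ∸ toℕ i ℕ.+ toℕ i) % k         ≡⟨ cong (_% k) (ℕP.m∸n+n≡m i≤j+k) ⟩
    (toℕ j ℕ.+ k) % k                             ≡⟨ [m+n]%n≡m%n (toℕ j) k ⟩
    toℕ j % k                                     ≡⟨ toℕ%k j ⟩
    toℕ j                                         ∎
    where
    open ≡-Reasoning
    i≤j+k : toℕ i ≤ toℕ j ℕ.+ k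
    i≤j+k = ℕP.≤-trans (ℕP.<⇒≤ (FinP.toℕ<n i)) (ℕP.m≤n+m k (toℕ j))

  offset-unique : ∀ r i j → (r ℕ.+ toℕ i) % k ≡ toℕ j → r % k ≡ offset i j
  offset-unique r i j eq =
    trans (%-cancelʳ-+ r (offset i j) (ℕP.<⇒≤ (FinP.toℕ<n i)) (trans eq (sym (offset-+ i j))))
          (m%n%n≡m%n ((toℕ j ℕ.+ k) ∸ toℕ i) k)

  offset-self : ∀ i → offset i i ≡ 0
  offset-self i = sym (offset-unique 0 i i (toℕ%k i))

  offset≡0⇔≡ : ∀ i j → offset i j ≡ 0 ⇔ toℕ i ≡ toℕ j
  offset≡0⇔≡ i j = mk⇔
    (λ o≡0 → trans (sym (toℕ%k i)) (trans (cong (λ r → (r ℕ.+ toℕ i) % k) (sym o≡0)) (offset-+ i j)))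
    (λ i≡j → subst (λ t → offset i t ≡ 0) (FinP.toℕ-injective i≡j) (offset-self i))

  offset≡m⇔≡shift : ∀ i j → offset i j ≡ m ⇔ toℕ i ≡ toℕ (shift j)
  offset≡m⇔≡shift i j = mk⇔ to from
    where
    open ≡-Reasoning
    to : offset i j ≡ m → toℕ i ≡ toℕ (shift j)
    to o≡m = sym (begin
      toℕ (shift j)                         ≡⟨ toℕ-shift j ⟩
      (1 ℕ.+ toℕ j) % k                     ≡⟨ cong (λ x → (1 ℕ.+ x) % k) (offset-+ i j) ⟨
      (1 ℕ.+ (offset i j ℕ.+ toℕ i) % k) % k ≡⟨ [m+n%d]%d≡[m+n]%d 1 (offset i j ℕ.+ toℕ i) k ⟩
      suc (offset i j ℕ.+ toℕ i) % k        ≡⟨ cong (λ o → suc (o ℕ.+ toℕ i) % k) o≡m ⟩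
      (k ℕ.+ toℕ i) % k                     ≡⟨ cong (_% k) (ℕP.+-comm k (toℕ i)) ⟩
      (toℕ i ℕ.+ k) % k                     ≡⟨ [m+n]%n≡m%n (toℕ i) k ⟩
      toℕ i % k                             ≡⟨ toℕ%k i ⟩
      toℕ i                                 ∎)
    from : toℕ i ≡ toℕ (shift j) → offset i j ≡ m
    from i≡sj = trans (sym (offset-unique m i j (begin
      (m ℕ.+ toℕ i) % k                     ≡⟨ cong (λ x → (m ℕ.+ x) % k) (trans i≡sj (toℕ-shift j)) ⟩
      (m ℕ.+ suc (toℕ j) % k) % k           ≡⟨ [m+n%d]%d≡[m+n]%d m (suc (toℕ j)) k ⟩
      (m ℕ.+ suc (toℕ j)) % k               ≡⟨ cong (_% k) (ℕP.+-comm m (suc (toℕ j))) ⟩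
      suc (toℕ j ℕ.+ m) % k                 ≡⟨ cong (_% k) (ℕP.+-suc (toℕ j) m) ⟨
      (toℕ j ℕ.+ k) % k                     ≡⟨ [m+n]%n≡m%n (toℕ j) k ⟩
      toℕ j % k                             ≡⟨ toℕ%k j ⟩
      toℕ j                                 ∎))) (m<n⇒m%n≡m (ℕP.n<1+n m))

  offset-rotate : ∀ a r i i′ j → r ℕ.+ a ≡ k → toℕ i′ ≡ (toℕ i ℕ.+ a) % k →
    (offset i j ℕ.+ r) % k ≡ offset i′ j
  offset-rotate a r i i′ j r+a≡k i′≡i+a = offset-unique (offset i j ℕ.+ r) i′ j (begin
    (offset i j ℕ.+ r ℕ.+ toℕ i′) % k            ≡⟨ cong (λ x → (offset i j ℕ.+ r ℕ.+ x) % k) i′≡i+a ⟩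
    (offset i j ℕ.+ r ℕ.+ (toℕ i ℕ.+ a) % k) % k ≡⟨ [m+n%d]%d≡[m+n]%d (offset i j ℕ.+ r) (toℕ i ℕ.+ a) k ⟩
    (offset i j ℕ.+ r ℕ.+ (toℕ i ℕ.+ a)) % k     ≡⟨ cong (_% k) (+-interchange (offset i j) r (toℕ i) a) ⟩
    (offset i j ℕ.+ toℕ i ℕ.+ (r ℕ.+ a)) % k     ≡⟨ cong (λ x → (offset i j ℕ.+ toℕ i ℕ.+ x) % k) r+a≡k ⟩
    (offset i j ℕ.+ toℕ i ℕ.+ k) % k             ≡⟨ [m+n]%n≡m%n (offset i j ℕ.+ toℕ i) k ⟩
    (offset i j ℕ.+ toℕ i) % k                   ≡⟨ offset-+ i j ⟩
    toℕ j                                        ∎)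
    where open ≡-Reasoning

  offset-shift : ∀ i j → (offset i j ℕ.+ m) % k ≡ offset (shift i) j
  offset-shift i j = offset-rotate 1 m i (shift i) j (ℕP.+-comm m 1)
    (trans (toℕ-shift i) (cong (_% k) (ℕP.+-comm 1 (toℕ i))))

  offset-unshift : ∀ i j → (offset i j ℕ.+ 1) % k ≡ offset (unshift i) j
  offset-unshift i j = offset-rotate m 1 i (unshift i) j refl (toℕ-unshift i)

  offset-swap : ∀ i j → (k ∸ offset i j) % k ≡ offset j i
  offset-swap i j = offset-unique (k ∸ offset i j) j i (begin
    (k ∸ o ℕ.+ toℕ j) % k             ≡⟨ cong (λ x → (k ∸ o ℕ.+ x) % k) (offset-+ i j) ⟨
    (k ∸ o ℕ.+ (o ℕ.+ toℕ i) % k) % k ≡⟨ [m+n%d]%d≡[m+n]%d (k ∸ o) (o ℕ.+ toℕ i) k ⟩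
    (k ∸ o ℕ.+ (o ℕ.+ toℕ i)) % k     ≡⟨ cong (_% k) (ℕP.+-assoc (k ∸ o) o (toℕ i)) ⟨
    (k ∸ o ℕ.+ o ℕ.+ toℕ i) % k       ≡⟨ cong (λ x → (x ℕ.+ toℕ i) % k) (ℕP.m∸n+n≡m (ℕP.<⇒≤ (offset<k i j))) ⟩
    (k ℕ.+ toℕ i) % k                 ≡⟨ cong (_% k) (ℕP.+-comm k (toℕ i)) ⟩
    (toℕ i ℕ.+ k) % k                 ≡⟨ [m+n]%n≡m%n (toℕ i) k ⟩
    toℕ i % k                         ≡⟨ toℕ%k i ⟩
    toℕ i                             ∎)
    where
    open ≡-Reasoning
    o = offset i j

  toℕ-circIndex : ∀ i j → toℕ (fromℕ< (m%n<n ((toℕ j ℕ.+ k) ∸ toℕ i) k)) ≡ offset i j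
  toℕ-circIndex i j = FinP.toℕ-fromℕ< _

  circ-offset : ∀ (h : ℕ → ℚ) i j → circ (h ∘ toℕ) i j ≡ h (offset i j)
  circ-offset h i j = cong h (toℕ-circIndex i j)

CCᵀ+I : (k : ℕ) → Matrix k k
CCᵀ+I k = (Cmat k · (Cmat k ᵀ)) ⊕ Id k

module RimMatrix (m : ℕ) (0<m : 0 < m) where
  open Cyclic m

  C A : Matrix k k
  C = Cmat k
  A = CCᵀ+I k

  firstLast-Id : ∀ l → firstLast k l ≡ Id k l Fin.zero + Id k l (fromℕ m)
  firstLast-Id l with toℕ l ℕ.≟ 0 | toℕ l ℕ.≟ m
  ... | yes l≡0 | _       = sym (cong (1ℚ +_) (Id-≢ l (fromℕ m) (λ l≡m → ℕP.<⇒≢ 0<m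
                                  (trans (sym l≡0) (trans l≡m (FinP.toℕ-fromℕ m))))))
  ... | no _    | yes l≡m = sym (cong (0ℚ +_) (Id-≡ l (fromℕ m) (trans l≡m (sym (FinP.toℕ-fromℕ m)))))
  ... | no _    | no l≢m  = sym (cong (0ℚ +_) (Id-≢ l (fromℕ m) (λ e → l≢m (trans e (FinP.toℕ-fromℕ m)))))

  C≡I+S : ∀ i t → C i t ≡ Id k i t + Id k i (shift t)
  C≡I+S i t = trans (firstLast-Id L)
    (cong₂ _+_ (Id-cong-⇔ L Fin.zero i t L≡0⇔i≡t) (Id-cong-⇔ L (fromℕ m) i (shift t) L≡m⇔i≡st))
    where
    L = fromℕ< (m%n<n ((toℕ t ℕ.+ k) ∸ toℕ i) k)
    L≡0⇔i≡t : toℕ L ≡ 0 ⇔ toℕ i ≡ toℕ t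
    L≡0⇔i≡t = subst (λ x → x ≡ 0 ⇔ toℕ i ≡ toℕ t) (sym (toℕ-circIndex i t)) (offset≡0⇔≡ i t)
    L≡m⇔i≡st : toℕ L ≡ toℕ (fromℕ m) ⇔ toℕ i ≡ toℕ (shift t)
    L≡m⇔i≡st = subst₂ (λ x y → x ≡ y ⇔ toℕ i ≡ toℕ (shift t))
                 (sym (toℕ-circIndex i t)) (sym (FinP.toℕ-fromℕ m)) (offset≡m⇔≡shift i t)

  ∑-C-row : ∀ i (f : Fin k → ℚ) → ∑ k (λ t → C i t * f t) ≡ f i + f (unshift i)
  ∑-C-row i f = begin
    ∑ k (λ t → C i t * f t)
      ≡⟨ ∑-cong k (λ t → trans (cong (_* f t) (C≡I+S i t))
                               (ℚP.*-distribʳ-+ (f t) (Id k i t) (Id k i (shift t)))) ⟩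
    ∑ k (λ t → Id k i t * f t + Id k i (shift t) * f t)
      ≡⟨ ∑-+ k (λ t → Id k i t * f t) (λ t → Id k i (shift t) * f t) ⟩
    ∑ k (λ t → Id k i t * f t) + ∑ k (λ t → Id k i (shift t) * f t)
      ≡⟨ cong₂ _+_ (∑-Idˡ k i f) (∑-select k _ (unshift i) off-preimage) ⟩
    f i + Id k i (shift (unshift i)) * f (unshift i)
      ≡⟨ cong (λ x → f i + Id k i x * f (unshift i)) (shift-unshift i) ⟩
    f i + Id k i i * f (unshift i)
      ≡⟨ cong (λ x → f i + x * f (unshift i)) (Id-≡ i i refl) ⟩
    f i + 1ℚ * f (unshift i)
      ≡⟨ cong (f i +_) (ℚP.*-identityˡ _) ⟩
    f i + f (unshift i)
      ∎
    where
    open ≡-Reasoning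
    off-preimage : ∀ t → t ≢ unshift i → Id k i (shift t) * f t ≡ 0ℚ
    off-preimage t t≢ui = trans (cong (_* f t) (Id-≢ i (shift t) (λ i≡st →
        t≢ui (trans (sym (unshift-shift t)) (cong unshift (sym (FinP.toℕ-injective i≡st)))))))
      (ℚP.*-zeroˡ (f t))

  ∑-C-col : ∀ j (f : Fin k → ℚ) → ∑ k (λ t → C t j * f t) ≡ f j + f (shift j)
  ∑-C-col j f = begin
    ∑ k (λ t → C t j * f t)
      ≡⟨ ∑-cong k (λ t → trans (cong (_* f t) (C≡I+S t j))
                               (ℚP.*-distribʳ-+ (f t) (Id k t j) (Id k t (shift j)))) ⟩
    ∑ k (λ t → Id k t j * f t + Id k t (shift j) * f t)
      ≡⟨ ∑-+ k (λ t → Id k t j * f t) (λ t → Id k t (shift j) * f t) ⟩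
    ∑ k (λ t → Id k t j * f t) + ∑ k (λ t → Id k t (shift j) * f t)
      ≡⟨ cong₂ _+_ (∑-Idᵀ j) (∑-Idᵀ (shift j)) ⟩
    f j + f (shift j)
      ∎
    where
    open ≡-Reasoning
    ∑-Idᵀ : ∀ a → ∑ k (λ t → Id k t a * f t) ≡ f a
    ∑-Idᵀ a = trans (∑-cong k (λ t → cong (_* f t) (Id-sym k t a))) (∑-Idˡ k a f)

  A·-stencil : ∀ (V : Matrix k k) i j →
    (A · V) i j ≡ ℕtoℚ 3 * V i j + V (shift i) j + V (unshift i) j
  A·-stencil V i j = begin
    ∑ k (λ t → (∑ k (λ l → C i l * C t l) + Id k i t) * V t j)
      ≡⟨ ∑-cong k (λ t → cong (λ x → (x + Id k i t) * V t j) (∑-C-row i (C t))) ⟩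
    ∑ k (λ t → (C t i + C t (unshift i) + Id k i t) * V t j)
      ≡⟨ ∑-cong k (λ t → solve 4 (λ a b c v → (a :+ b :+ c) :* v := a :* v :+ b :* v :+ c :* v) refl
                           (C t i) (C t (unshift i)) (Id k i t) (V t j)) ⟩
    ∑ k (λ t → C t i * V t j + C t (unshift i) * V t j + Id k i t * V t j)
      ≡⟨ trans (∑-+ k (λ t → C t i * V t j + C t (unshift i) * V t j) (λ t → Id k i t * V t j))
               (cong (_+ ∑ k (λ t → Id k i t * V t j))
                     (∑-+ k (λ t → C t i * V t j) (λ t → C t (unshift i) * V t j))) ⟩
    ∑ k (λ t → C t i * V t j) + ∑ k (λ t → C t (unshift i) * V t j) + ∑ k (λ t → Id k i t * V t j)
      ≡⟨ cong₂ _+_ (cong₂ _+_ (∑-C-col i (λ t → V t j)) (∑-C-col (unshift i) (λ t → V t j)))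
                   (∑-Idˡ k i (λ t → V t j)) ⟩
    V i j + V (shift i) j + (V (unshift i) j + V (shift (unshift i)) j) + V i j
      ≡⟨ cong (λ x → V i j + V (shift i) j + (V (unshift i) j + V x j) + V i j) (shift-unshift i) ⟩
    V i j + V (shift i) j + (V (unshift i) j + V i j) + V i j
      ≡⟨ solve 3 (λ a b c → a :+ b :+ (c :+ a) :+ a := con (ℕtoℚ 3) :* a :+ b :+ c) refl
           (V i j) (V (shift i) j) (V (unshift i) j) ⟩
    ℕtoℚ 3 * V i j + V (shift i) j + V (unshift i) j
      ∎
    where open ≡-Reasoning

  A-symmetric : Symmetric A
  A-symmetric i j = cong₂ _+_ (∑-cong k (λ t → ℚP.*-comm (C j t) (C i t))) (Id-sym k j i)

  A-rowSum : ∀ i → ∑ k (A i) ≡ ℕtoℚ 5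
  A-rowSum i = trans (∑-cong k (λ t → sym (ℚP.*-identityʳ (A i t)))) (A·-stencil (J k) i i)

p≤q⇒0≤q-p : ∀ {p q} → p ≤ℚ q → 0ℚ ≤ℚ q - p
p≤q⇒0≤q-p {p} {q} p≤q = subst (_≤ℚ q - p) (ℚP.+-inverseʳ p) (ℚP.+-monoˡ-≤ (- p) p≤q)

p≤p+q : ∀ p {q} → 0ℚ ≤ℚ q → p ≤ℚ p + q
p≤p+q p 0≤q = subst (_≤ℚ p + _) (ℚP.+-identityʳ p) (ℚP.+-monoʳ-≤ p 0≤q)

altSign : ℕ → ℚ
altSign zero    = - 1ℚ
altSign (suc n) = - altSign n

altSign-±1 : ∀ n → altSign n ≡ 1ℚ ⊎ altSign n ≡ - 1ℚ
altSign-±1 zero = inj₂ refl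
altSign-±1 (suc n) with altSign-±1 n
... | inj₁ σ≡1  = inj₂ (cong -_ σ≡1)
... | inj₂ σ≡-1 = inj₁ (cong -_ σ≡-1)

-- evenFib n is the Fibonacci number F(2n).
evenFib : ℕ → ℚ
evenFib zero          = 0ℚ
evenFib (suc zero)    = 1ℚ
evenFib (suc (suc n)) = ℕtoℚ 3 * evenFib (suc n) - evenFib n

signedEvenFib : ℕ → ℚ
signedEvenFib n = altSign n * evenFib n

signedEvenFib-rec : ∀ n →
  signedEvenFib n + ℕtoℚ 3 * signedEvenFib (suc n) + signedEvenFib (suc (suc n)) ≡ 0ℚ
signedEvenFib-rec n =
  solve 3 (λ σ a b → σ :* a :+ con (ℕtoℚ 3) :* ((:- σ) :* b) :+ (:- (:- σ)) :* (con (ℕtoℚ 3) :* b :- a)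
                     := con 0ℚ)
    refl (altSign n) (evenFib n) (evenFib (suc n))

evenFib-mono : ∀ n → 0ℚ ≤ℚ evenFib n × evenFib n ≤ℚ evenFib (suc n)
evenFib-mono zero    = ℚP.≤-refl , toWitness {a? = 0ℚ ℚP.≤? 1ℚ} _
evenFib-mono (suc n) with evenFib-mono n
... | 0≤a , a≤b = 0≤b , subst (b ≤ℚ_) b+[[b-a]+b]≡3b-a (p≤p+q b (ℚP.+-mono-≤ (p≤q⇒0≤q-p a≤b) 0≤b))
  where
  a = evenFib n
  b = evenFib (suc n)
  0≤b = ℚP.≤-trans 0≤a a≤b
  b+[[b-a]+b]≡3b-a : b + ((b - a) + b) ≡ ℕtoℚ 3 * b - a
  b+[[b-a]+b]≡3b-a = solve 2 (λ a b → b :+ ((b :- a) :+ b) := con (ℕtoℚ 3) :* b :- a) refl a b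

3≤evenFib : ∀ n → ℕtoℚ 3 ≤ℚ evenFib (suc (suc n))
3≤evenFib zero    = ℚP.≤-refl
3≤evenFib (suc n) = ℚP.≤-trans (3≤evenFib n) (proj₂ (evenFib-mono (suc (suc n))))

3≤3evenFib-2evenFib : ∀ n →
  ℕtoℚ 3 ≤ℚ ℕtoℚ 3 * evenFib (suc (suc n)) - ℕtoℚ 2 * evenFib (suc n)
3≤3evenFib-2evenFib n = ℚP.≤-trans (3≤evenFib n)
  (subst (b ≤ℚ_) b+[[b-a]+[b-a]]≡3b-2a (p≤p+q b (ℚP.+-mono-≤ 0≤b-a 0≤b-a)))
  where
  a = evenFib (suc n)
  b = evenFib (suc (suc n))
  0≤b-a = p≤q⇒0≤q-p (proj₂ (evenFib-mono (suc n)))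
  b+[[b-a]+[b-a]]≡3b-2a : b + ((b - a) + (b - a)) ≡ ℕtoℚ 3 * b - ℕtoℚ 2 * a
  b+[[b-a]+[b-a]]≡3b-2a =
    solve 2 (λ a b → b :+ ((b :- a) :+ (b :- a)) := con (ℕtoℚ 3) :* b :- con (ℕtoℚ 2) :* a) refl a b

module CirculantInverse (m₁ : ℕ) where
  m : ℕ
  m = suc m₁

  open Cyclic m
  open RimMatrix m (s≤s z≤n)

  D : ℚ
  D = ℕtoℚ 2 + ℕtoℚ 2 * signedEvenFib m + ℕtoℚ 3 * signedEvenFib k

  E : ℚ
  E = ℕtoℚ 3 * evenFib k - ℕtoℚ 2 * evenFib m

  D≡2-σE : D ≡ ℕtoℚ 2 - altSign m * E
  D≡2-σE = solve 3 (λ σ a b → con (ℕtoℚ 2) :+ con (ℕtoℚ 2) :* (σ :* a) :+ con (ℕtoℚ 3) :* ((:- σ) :* b)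
                              := con (ℕtoℚ 2) :- σ :* (con (ℕtoℚ 3) :* b :- con (ℕtoℚ 2) :* a))
             refl (altSign m) (evenFib m) (evenFib k)

  σE≡2 : D ≡ 0ℚ → altSign m * E ≡ ℕtoℚ 2
  σE≡2 D≡0 = begin
    altSign m * E                          ≡⟨ solve 1 (λ x → x := con (ℕtoℚ 2) :- (con (ℕtoℚ 2) :- x)) refl (altSign m * E) ⟩
    ℕtoℚ 2 - (ℕtoℚ 2 - altSign m * E)      ≡⟨ cong (λ x → ℕtoℚ 2 - x) (trans (sym D≡2-σE) D≡0) ⟩
    ℕtoℚ 2 - 0ℚ                            ≡⟨⟩
    ℕtoℚ 2                                 ∎
    where open ≡-Reasoning

  D≢0 : D ≢ 0ℚ
  D≢0 D≡0 with altSign-±1 m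
  ... | inj₁ σ≡1  = toWitnessFalse {a? = ℕtoℚ 3 ℚP.≤? ℕtoℚ 2} _
                      (subst (ℕtoℚ 3 ≤ℚ_) E≡2 (3≤3evenFib-2evenFib m₁))
    where
    E≡2 : E ≡ ℕtoℚ 2
    E≡2 = trans (sym (ℚP.*-identityˡ E)) (trans (cong (_* E) (sym σ≡1)) (σE≡2 D≡0))
  ... | inj₂ σ≡-1 = toWitnessFalse {a? = ℕtoℚ 3 ℚP.≤? - ℕtoℚ 2} _
                      (subst (ℕtoℚ 3 ≤ℚ_) E≡-2 (3≤3evenFib-2evenFib m₁))
    where
    E≡-2 : E ≡ - ℕtoℚ 2
    E≡-2 = trans (solve 1 (λ e → e := :- ((:- con 1ℚ) :* e)) refl E)
                 (cong -_ (trans (cong (_* E) (sym σ≡-1)) (σE≡2 D≡0)))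

  instance
    D-nonZero : NonZero D
    D-nonZero = ≢-nonZero D≢0

  -- Both summands solve the homogeneous recurrence, their sum is invariant under e ↦ k ∸ e,
  -- and dividing by D makes the equation at e = 0 hold.
  g : ℕ → ℚ
  g e = (signedEvenFib e + signedEvenFib (k ∸ e)) * 1/ D

  g-sym : ∀ e → e ≤ k → g (k ∸ e) ≡ g e
  g-sym e e≤k = trans (cong (λ x → (signedEvenFib (k ∸ e) + signedEvenFib x) * 1/ D) (ℕP.m∸[m∸n]≡n e≤k))
                      (cong (_* 1/ D) (ℚP.+-comm (signedEvenFib (k ∸ e)) (signedEvenFib e)))

  g-rec : ∀ d → suc (suc d) ≤ k → g d + ℕtoℚ 3 * g (suc d) + g (suc (suc d)) ≡ 0ℚ
  g-rec d 2+d≤k rewrite ℕP.+-∸-assoc 1 (ℕP.<⇒≤ 2+d≤k) | ℕP.+-∸-assoc 1 2+d≤k = begin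
    (s d + s (suc (suc f))) * 1/ D + ℕtoℚ 3 * ((s (suc d) + s (suc f)) * 1/ D) + (s (suc (suc d)) + s f) * 1/ D
      ≡⟨ solve 7 (λ a₀ a₁ a₂ b₀ b₁ b₂ x →
                    (a₀ :+ b₂) :* x :+ con (ℕtoℚ 3) :* ((a₁ :+ b₁) :* x) :+ (a₂ :+ b₀) :* x
                    := ((a₀ :+ con (ℕtoℚ 3) :* a₁ :+ a₂) :+ (b₀ :+ con (ℕtoℚ 3) :* b₁ :+ b₂)) :* x)
           refl (s d) (s (suc d)) (s (suc (suc d))) (s f) (s (suc f)) (s (suc (suc f))) (1/ D) ⟩
    ((s d + ℕtoℚ 3 * s (suc d) + s (suc (suc d))) + (s f + ℕtoℚ 3 * s (suc f) + s (suc (suc f)))) * 1/ D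
      ≡⟨ cong₂ (λ x y → (x + y) * 1/ D) (signedEvenFib-rec d) (signedEvenFib-rec f) ⟩
    (0ℚ + 0ℚ) * 1/ D
      ≡⟨ ℚP.*-zeroˡ (1/ D) ⟩
    0ℚ
      ∎
    where
    open ≡-Reasoning
    s = signedEvenFib
    f = k ∸ suc (suc d)

  g-norm : ℕtoℚ 3 * g 0 + g m + g 1 ≡ 1ℚ
  g-norm = begin
    ℕtoℚ 3 * g 0 + g m + g 1          ≡⟨ cong (λ x → ℕtoℚ 3 * g 0 + x + g 1) (g-sym 1 (s≤s z≤n)) ⟩
    ℕtoℚ 3 * g 0 + g 1 + g 1          ≡⟨ solve 3 (λ a b x → con (ℕtoℚ 3) :* ((con 0ℚ :+ b) :* x)
                                                   :+ (con 1ℚ :+ a) :* x :+ (con 1ℚ :+ a) :* x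
                                                   := (con (ℕtoℚ 2) :+ con (ℕtoℚ 2) :* a :+ con (ℕtoℚ 3) :* b) :* x)
                                            refl (signedEvenFib m) (signedEvenFib k) (1/ D) ⟩
    D * 1/ D                          ≡⟨ ℚP.*-inverseʳ D ⟩
    1ℚ                                ∎
    where open ≡-Reasoning

  g-mod : ∀ e → e ≤ k → g (e % k) ≡ g e
  g-mod e e≤k with ℕP.m≤n⇒m<n∨m≡n e≤k
  ... | inj₁ e<k  = cong g (m<n⇒m%n≡m e<k)
  ... | inj₂ refl = trans (cong g (n%n≡0 k)) (sym (g-sym 0 z≤n))

  g-stencil : ∀ i j →
    ℕtoℚ 3 * g (offset i j) + g ((offset i j ℕ.+ m) % k) + g ((offset i j ℕ.+ 1) % k) ≡ Id k i j
  g-stencil i j with offset i j | offset≡0⇔≡ i j | offset<k i j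
  ... | zero  | o≡0⇔i≡j | _ =
    trans (cong (λ x → ℕtoℚ 3 * g 0 + g x + g 1) (m<n⇒m%n≡m (ℕP.n<1+n m)))
          (trans g-norm (sym (Id-≡ i j (Equivalence.to o≡0⇔i≡j refl))))
  ... | suc d | o≡0⇔i≡j | 1+d<k = begin
    ℕtoℚ 3 * g (suc d) + g ((suc d ℕ.+ m) % k) + g ((suc d ℕ.+ 1) % k)
      ≡⟨ cong₂ (λ x y → ℕtoℚ 3 * g (suc d) + g x + g (suc y % k)) d+m%k≡d (ℕP.+-comm d 1) ⟩
    ℕtoℚ 3 * g (suc d) + g d + g (suc (suc d) % k)
      ≡⟨ cong (λ x → ℕtoℚ 3 * g (suc d) + g d + x) (g-mod (suc (suc d)) 1+d<k) ⟩
    ℕtoℚ 3 * g (suc d) + g d + g (suc (suc d))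
      ≡⟨ solve 3 (λ a b c → con (ℕtoℚ 3) :* b :+ a :+ c := a :+ con (ℕtoℚ 3) :* b :+ c) refl
           (g d) (g (suc d)) (g (suc (suc d))) ⟩
    g d + ℕtoℚ 3 * g (suc d) + g (suc (suc d))
      ≡⟨ g-rec d 1+d<k ⟩
    0ℚ
      ≡⟨ sym (Id-≢ i j (λ i≡j → ℕP.1+n≢0 (Equivalence.from o≡0⇔i≡j i≡j))) ⟩
    Id k i j
      ∎
    where
    open ≡-Reasoning
    d+m%k≡d : (suc d ℕ.+ m) % k ≡ d
    d+m%k≡d = trans (cong (_% k) (sym (ℕP.+-suc d m))) (trans ([m+n]%n≡m%n d k)
                    (m<n⇒m%n≡m (ℕP.<-trans (ℕP.n<1+n d) 1+d<k)))

  Inv : Matrix k k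
  Inv = circ (g ∘ toℕ)

  CCᵀ+I·Inv≋I : A · Inv ≋ Id k
  CCᵀ+I·Inv≋I i j = begin
    (A · Inv) i j
      ≡⟨ A·-stencil Inv i j ⟩
    ℕtoℚ 3 * Inv i j + Inv (shift i) j + Inv (unshift i) j
      ≡⟨ cong₂ (λ x y → ℕtoℚ 3 * Inv i j + x + y)
           (trans (circ-offset g (shift i) j) (cong g (sym (offset-shift i j))))
           (trans (circ-offset g (unshift i) j) (cong g (sym (offset-unshift i j)))) ⟩
    ℕtoℚ 3 * Inv i j + g ((offset i j ℕ.+ m) % k) + g ((offset i j ℕ.+ 1) % k)
      ≡⟨ cong (λ x → ℕtoℚ 3 * x + g ((offset i j ℕ.+ m) % k) + g ((offset i j ℕ.+ 1) % k))
              (circ-offset g i j) ⟩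
    ℕtoℚ 3 * g (offset i j) + g ((offset i j ℕ.+ m) % k) + g ((offset i j ℕ.+ 1) % k)
      ≡⟨ g-stencil i j ⟩
    Id k i j
      ∎
    where open ≡-Reasoning

  Inv-symmetric : Symmetric Inv
  Inv-symmetric i j = begin
    Inv j i                      ≡⟨ circ-offset g j i ⟩
    g (offset j i)               ≡⟨ cong g (offset-swap i j) ⟨
    g ((k ∸ offset i j) % k)     ≡⟨ g-mod (k ∸ offset i j) (ℕP.m∸n≤m k (offset i j)) ⟩
    g (k ∸ offset i j)           ≡⟨ g-sym (offset i j) (ℕP.<⇒≤ (offset<k i j)) ⟩
    g (offset i j)               ≡⟨ circ-offset g i j ⟨
    Inv i j                      ∎
    where open ≡-Reasoning

  Inv·CCᵀ+I≋I : Inv · A ≋ Id k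
  Inv·CCᵀ+I≋I = symmetric-rightInverse⇒leftInverse A-symmetric Inv-symmetric CCᵀ+I·Inv≋I

ℕtoℚ-suc-nonZero : ∀ n → NonZero (ℕtoℚ (suc n))
ℕtoℚ-suc-nonZero n rewrite ℕtoℚ≡mkℚ (suc n) = _

1/-cong : ∀ {p q} → p ≡ q → {{_ : NonZero p}} {{_ : NonZero q}} → 1/ p ≡ 1/ q
1/-cong refl = refl

inv2k-*-double : ∀ m → inv2k (suc m) * (ℕtoℚ (suc m) + ℕtoℚ (suc m)) ≡ 1ℚ
inv2k-*-double m = begin
  inv2k k * (ℕtoℚ k + ℕtoℚ k)  ≡⟨ cong₂ _*_ inv2k≡1/ (sym double) ⟩
  1/ ℕtoℚ 2k * ℕtoℚ 2k         ≡⟨ ℚP.*-inverseˡ (ℕtoℚ 2k) ⟩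
  1ℚ                           ∎
  where
  open ≡-Reasoning
  k = suc m
  2k = 2 ℕ.* k
  instance
    2k-nonZero : NonZero (ℕtoℚ 2k)
    2k-nonZero = ℕtoℚ-suc-nonZero (m ℕ.+ 1 ℕ.* k)
  inv2k≡1/ : inv2k k ≡ 1/ ℕtoℚ 2k
  inv2k≡1/ = trans (ℚP.normalize-coprime (λ (d∣1 , _) → ∣1⇒≡1 d∣1))
                   (sym (1/-cong (ℕtoℚ≡mkℚ 2k)))
  double : ℕtoℚ 2k ≡ ℕtoℚ k + ℕtoℚ k
  double = trans (cong (λ x → ℕtoℚ (k ℕ.+ x)) (ℕP.+-identityʳ k)) (ℕtoℚ-+ k k)

module PseudoInverse (m : ℕ) (0<m : 0 < m) (Inv : Matrix (suc m) (suc m))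
  (Inv-symmetric : Symmetric Inv)
  (A·Inv≋I : CCᵀ+I (suc m) · Inv ≋ Id (suc m)) where

  open Cyclic m
  open RimMatrix m 0<m

  fifth : ℚ
  fifth = ℤ.+ 1 / 5

  Inv·A≋I : Inv · A ≋ Id k
  Inv·A≋I = symmetric-rightInverse⇒leftInverse A-symmetric Inv-symmetric A·Inv≋I

  Inv-rowSum : ∀ i → ∑ k (Inv i) ≡ fifth
  Inv-rowSum i = begin
    ∑ k (Inv i)                       ≡⟨ solve 1 (λ x → x := x :* con (ℕtoℚ 5) :* con fifth) refl (∑ k (Inv i)) ⟩
    ∑ k (Inv i) * ℕtoℚ 5 * fifth      ≡⟨ cong (_* fifth) (leftInverse-rowSum A Inv (ℕtoℚ 5) Inv·A≋I A-rowSum i) ⟩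
    1ℚ * fifth                        ≡⟨ ℚP.*-identityˡ fifth ⟩
    fifth                             ∎
    where open ≡-Reasoning

  Inv-colSum : ∀ j → ∑ k (λ t → Inv t j) ≡ fifth
  Inv-colSum j = trans (∑-cong k (λ t → Inv-symmetric j t)) (Inv-rowSum j)

  c : ℚ
  c = ℕtoℚ k

  X Y : Matrix k k
  X = Xmat k Inv
  Y = Ymat k Inv

  X≡2[cInv-fifth] : ∀ a i → X a i ≡ ℕtoℚ 2 * (c * Inv a i - fifth)
  X≡2[cInv-fifth] a i = cong (ℕtoℚ 2 *_) (begin
    ∑ k (λ l → Inv a l * (c * Id k l i + - 1ℚ * 1ℚ))
      ≡⟨ ∑-cong k (λ l → solve 3 (λ v c d → v :* (c :* d :+ (:- con 1ℚ) :* con 1ℚ)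
                                          := c :* (v :* d) :+ (:- con 1ℚ) :* v) refl (Inv a l) c (Id k l i)) ⟩
    ∑ k (λ l → c * (Inv a l * Id k l i) + - 1ℚ * Inv a l)
      ≡⟨ ∑-+ k (λ l → c * (Inv a l * Id k l i)) (λ l → - 1ℚ * Inv a l) ⟩
    ∑ k (λ l → c * (Inv a l * Id k l i)) + ∑ k (λ l → - 1ℚ * Inv a l)
      ≡⟨ cong₂ _+_ (∑-*ˡ k c (λ l → Inv a l * Id k l i)) (∑-*ˡ k (- 1ℚ) (Inv a)) ⟩
    c * ∑ k (λ l → Inv a l * Id k l i) + - 1ℚ * ∑ k (Inv a)
      ≡⟨ cong₂ (λ x y → c * x + - 1ℚ * y) (∑-Idʳ k i (Inv a)) (Inv-rowSum a) ⟩
    c * Inv a i + - 1ℚ * fifth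
      ≡⟨ solve 2 (λ x y → x :+ (:- con 1ℚ) :* y := x :- y) refl (c * Inv a i) fifth ⟩
    c * Inv a i - fifth
      ∎)
    where open ≡-Reasoning

  X-symmetric : Symmetric X
  X-symmetric a i = begin
    X i a                                  ≡⟨ X≡2[cInv-fifth] i a ⟩
    ℕtoℚ 2 * (c * Inv i a - fifth)         ≡⟨ cong (λ x → ℕtoℚ 2 * (c * x - fifth)) (Inv-symmetric a i) ⟩
    ℕtoℚ 2 * (c * Inv a i - fifth)         ≡⟨ X≡2[cInv-fifth] a i ⟨
    X a i                                  ∎
    where open ≡-Reasoning

  X-colSum : ∀ j → ∑ k (λ a → X a j) ≡ 0ℚ
  X-colSum j = begin
    ∑ k (λ a → X a j)
      ≡⟨ ∑-cong k (λ a → trans (X≡2[cInv-fifth] a j)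
           (solve 3 (λ c v f → con (ℕtoℚ 2) :* (c :* v :- f) := (con (ℕtoℚ 2) :* c) :* v :+ (:- con (ℕtoℚ 2)) :* f)
              refl c (Inv a j) fifth)) ⟩
    ∑ k (λ a → (ℕtoℚ 2 * c) * Inv a j + - ℕtoℚ 2 * fifth)
      ≡⟨ ∑-+ k (λ a → (ℕtoℚ 2 * c) * Inv a j) (λ _ → - ℕtoℚ 2 * fifth) ⟩
    ∑ k (λ a → (ℕtoℚ 2 * c) * Inv a j) + ∑ k (λ _ → - ℕtoℚ 2 * fifth)
      ≡⟨ cong₂ _+_ (trans (∑-*ˡ k (ℕtoℚ 2 * c) (λ a → Inv a j)) (cong (ℕtoℚ 2 * c *_) (Inv-colSum j)))
                   (∑-const k (- ℕtoℚ 2 * fifth)) ⟩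
    (ℕtoℚ 2 * c) * fifth + c * (- ℕtoℚ 2 * fifth)
      ≡⟨ solve 2 (λ c f → (con (ℕtoℚ 2) :* c) :* f :+ c :* ((:- con (ℕtoℚ 2)) :* f) := con 0ℚ) refl c fifth ⟩
    0ℚ
      ∎
    where open ≡-Reasoning

  Y≡J+X+Xshift : ∀ b i → Y b i ≡ 1ℚ + (X b i + X (shift b) i)
  Y≡J+X+Xshift b i = cong (1ℚ +_) (∑-C-col b (λ l → X l i))

  X+CY≡2cI : ∀ i j → X i j + ∑ k (λ t → C i t * Y t j) ≡ (c + c) * Id k i j
  X+CY≡2cI i j = begin
    X i j + ∑ k (λ t → C i t * Y t j)
      ≡⟨ cong (X i j +_) (∑-C-row i (λ t → Y t j)) ⟩
    X i j + (Y i j + Y (unshift i) j)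
      ≡⟨ cong₂ (λ y y′ → X i j + (y + y′)) (Y≡J+X+Xshift i j) (Y≡J+X+Xshift (unshift i) j) ⟩
    X i j + ((1ℚ + (X i j + X (shift i) j)) + (1ℚ + (X (unshift i) j + X (shift (unshift i)) j)))
      ≡⟨ cong (λ t → X i j + ((1ℚ + (X i j + X (shift i) j)) + (1ℚ + (X (unshift i) j + X t j))))
              (shift-unshift i) ⟩
    X i j + ((1ℚ + (X i j + X (shift i) j)) + (1ℚ + (X (unshift i) j + X i j)))
      ≡⟨ cong₂ (λ x y → x + ((1ℚ + (x + y)) + (1ℚ + (X (unshift i) j + x))))
               (X≡2[cInv-fifth] i j) (X≡2[cInv-fifth] (shift i) j) ⟩
    x₀ + ((1ℚ + (x₀ + x₊)) + (1ℚ + (X (unshift i) j + x₀)))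
      ≡⟨ cong (λ y → x₀ + ((1ℚ + (x₀ + x₊)) + (1ℚ + (y + x₀)))) (X≡2[cInv-fifth] (unshift i) j) ⟩
    x₀ + ((1ℚ + (x₀ + x₊)) + (1ℚ + (x₋ + x₀)))
      ≡⟨ solve 4 (λ c a b d →
             two :* (c :* a :- con fifth) :+ ((con 1ℚ :+ (two :* (c :* a :- con fifth) :+ two :* (c :* b :- con fifth)))
               :+ (con 1ℚ :+ (two :* (c :* d :- con fifth) :+ two :* (c :* a :- con fifth))))
             := (c :+ c) :* (con (ℕtoℚ 3) :* a :+ b :+ d))
           refl c (Inv i j) (Inv (shift i) j) (Inv (unshift i) j) ⟩
    (c + c) * (ℕtoℚ 3 * Inv i j + Inv (shift i) j + Inv (unshift i) j)
      ≡⟨ cong ((c + c) *_) (trans (sym (A·-stencil Inv i j)) (A·Inv≋I i j)) ⟩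
    (c + c) * Id k i j
      ∎
    where
    open ≡-Reasoning
    two = con (ℕtoℚ 2)
    x₀ = ℕtoℚ 2 * (c * Inv i j - fifth)
    x₊ = ℕtoℚ 2 * (c * Inv (shift i) j - fifth)
    x₋ = ℕtoℚ 2 * (c * Inv (unshift i) j - fifth)

  M : Matrix (suc k) (k ℕ.+ k)
  M = Mmat k

  P : Matrix (k ℕ.+ k) (suc k)
  P = Pmat k Inv

  κ : ℚ
  κ = inv2k k

  M-hub-spoke : ∀ a → M Fin.zero (a ↑ˡ k) ≡ 1ℚ
  M-hub-spoke a rewrite FinP.splitAt-↑ˡ k a k = refl

  M-hub-rim : ∀ b → M Fin.zero (k ↑ʳ b) ≡ 0ℚ
  M-hub-rim b rewrite FinP.splitAt-↑ʳ k k b = refl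

  M-cycle-spoke : ∀ i a → M (Fin.suc i) (a ↑ˡ k) ≡ Id k i a
  M-cycle-spoke i a rewrite FinP.splitAt-↑ˡ k a k = refl

  M-cycle-rim : ∀ i b → M (Fin.suc i) (k ↑ʳ b) ≡ C i b
  M-cycle-rim i b rewrite FinP.splitAt-↑ʳ k k b = refl

  P-spoke-hub : ∀ a → P (a ↑ˡ k) Fin.zero ≡ κ * ℕtoℚ 2
  P-spoke-hub a rewrite FinP.splitAt-↑ˡ k a k = refl

  P-rim-hub : ∀ b → P (k ↑ʳ b) Fin.zero ≡ κ * - 1ℚ
  P-rim-hub b rewrite FinP.splitAt-↑ʳ k k b = refl

  P-spoke-cycle : ∀ a i → P (a ↑ˡ k) (Fin.suc i) ≡ κ * X a i
  P-spoke-cycle a i rewrite FinP.splitAt-↑ˡ k a k = refl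

  P-rim-cycle : ∀ b i → P (k ↑ʳ b) (Fin.suc i) ≡ κ * Y b i
  P-rim-cycle b i rewrite FinP.splitAt-↑ʳ k k b = refl

  κ*2c≡1 : κ * (c + c) ≡ 1ℚ
  κ*2c≡1 = inv2k-*-double m

  M·P≋I : M · P ≋ Id (suc k)
  M·P≋I i j = trans (∑-↑ k k (λ r → M i r * P r j)) (blocks i j)
    where
    open ≡-Reasoning
    spokes rims : Fin (suc k) → Fin (suc k) → ℚ
    spokes i j = ∑ k (λ a → M i (a ↑ˡ k) * P (a ↑ˡ k) j)
    rims   i j = ∑ k (λ b → M i (k ↑ʳ b) * P (k ↑ʳ b) j)
    hub-rims≡0 : ∀ j → rims Fin.zero j ≡ 0ℚ
    hub-rims≡0 j = ∑-zero k (λ b → trans (cong (_* P (k ↑ʳ b) j) (M-hub-rim b)) (ℚP.*-zeroˡ (P (k ↑ʳ b) j)))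
    blocks : ∀ i j → spokes i j + rims i j ≡ Id (suc k) i j
    blocks Fin.zero Fin.zero = begin
      spokes Fin.zero Fin.zero + rims Fin.zero Fin.zero
        ≡⟨ cong₂ _+_ (∑-cong k (λ a → trans (cong₂ _*_ (M-hub-spoke a) (P-spoke-hub a))
                                            (ℚP.*-identityˡ (κ * ℕtoℚ 2))))
                     (hub-rims≡0 Fin.zero) ⟩
      ∑ k (λ _ → κ * ℕtoℚ 2) + 0ℚ
        ≡⟨ cong (_+ 0ℚ) (∑-const k (κ * ℕtoℚ 2)) ⟩
      c * (κ * ℕtoℚ 2) + 0ℚ
        ≡⟨ solve 2 (λ c κ → c :* (κ :* con (ℕtoℚ 2)) :+ con 0ℚ := κ :* (c :+ c)) refl c κ ⟩
      κ * (c + c)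
        ≡⟨ κ*2c≡1 ⟩
      1ℚ
        ∎
    blocks Fin.zero (Fin.suc j) = begin
      spokes Fin.zero (Fin.suc j) + rims Fin.zero (Fin.suc j)
        ≡⟨ cong₂ _+_ (∑-cong k (λ a → trans (cong₂ _*_ (M-hub-spoke a) (P-spoke-cycle a j))
                                            (ℚP.*-identityˡ (κ * X a j))))
                     (hub-rims≡0 (Fin.suc j)) ⟩
      ∑ k (λ a → κ * X a j) + 0ℚ
        ≡⟨ cong (_+ 0ℚ) (trans (∑-*ˡ k κ (λ a → X a j)) (cong (κ *_) (X-colSum j))) ⟩
      κ * 0ℚ + 0ℚ
        ≡⟨ solve 1 (λ κ → κ :* con 0ℚ :+ con 0ℚ := con 0ℚ) refl κ ⟩
      0ℚ
        ∎
    blocks (Fin.suc i) Fin.zero = begin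
      spokes (Fin.suc i) Fin.zero + rims (Fin.suc i) Fin.zero
        ≡⟨ cong₂ _+_ (∑-cong k (λ a → cong₂ _*_ (M-cycle-spoke i a) (P-spoke-hub a)))
                     (∑-cong k (λ b → cong₂ _*_ (M-cycle-rim i b) (P-rim-hub b))) ⟩
      ∑ k (λ a → Id k i a * (κ * ℕtoℚ 2)) + ∑ k (λ b → C i b * (κ * - 1ℚ))
        ≡⟨ cong₂ _+_ (∑-Idˡ k i (λ _ → κ * ℕtoℚ 2)) (∑-C-row i (λ _ → κ * - 1ℚ)) ⟩
      κ * ℕtoℚ 2 + (κ * - 1ℚ + κ * - 1ℚ)
        ≡⟨ solve 1 (λ κ → κ :* con (ℕtoℚ 2) :+ (κ :* (:- con 1ℚ) :+ κ :* (:- con 1ℚ)) := con 0ℚ) refl κ ⟩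
      0ℚ
        ∎
    blocks (Fin.suc i) (Fin.suc j) = begin
      spokes (Fin.suc i) (Fin.suc j) + rims (Fin.suc i) (Fin.suc j)
        ≡⟨ cong₂ _+_ (∑-cong k (λ a → cong₂ _*_ (M-cycle-spoke i a) (P-spoke-cycle a j)))
                     (∑-cong k (λ b → trans (cong₂ _*_ (M-cycle-rim i b) (P-rim-cycle b j))
                        (solve 3 (λ x κ y → x :* (κ :* y) := κ :* (x :* y)) refl (C i b) κ (Y b j)))) ⟩
      ∑ k (λ a → Id k i a * (κ * X a j)) + ∑ k (λ b → κ * (C i b * Y b j))
        ≡⟨ cong₂ _+_ (∑-Idˡ k i (λ a → κ * X a j)) (∑-*ˡ k κ (λ b → C i b * Y b j)) ⟩
      κ * X i j + κ * ∑ k (λ b → C i b * Y b j)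
        ≡⟨ sym (ℚP.*-distribˡ-+ κ (X i j) _) ⟩
      κ * (X i j + ∑ k (λ b → C i b * Y b j))
        ≡⟨ cong (κ *_) (X+CY≡2cI i j) ⟩
      κ * ((c + c) * Id k i j)
        ≡⟨ sym (ℚP.*-assoc κ (c + c) (Id k i j)) ⟩
      κ * (c + c) * Id k i j
        ≡⟨ cong (_* Id k i j) κ*2c≡1 ⟩
      1ℚ * Id k i j
        ≡⟨ ℚP.*-identityˡ (Id k i j) ⟩
      Id k i j
        ≡⟨ sym (Id-suc k i j) ⟩
      Id (suc k) (Fin.suc i) (Fin.suc j)
        ∎

  P·M-spoke-spoke : ∀ a a′ → (P · M) (a ↑ˡ k) (a′ ↑ˡ k) ≡ κ * ℕtoℚ 2 + κ * X a a′
  P·M-spoke-spoke a a′ = cong₂ _+_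
    (trans (cong₂ _*_ (P-spoke-hub a) (M-hub-spoke a′)) (ℚP.*-identityʳ (κ * ℕtoℚ 2)))
    (trans (∑-cong k (λ i → cong₂ _*_ (P-spoke-cycle a i) (M-cycle-spoke i a′)))
           (∑-Idʳ k a′ (λ i → κ * X a i)))

  P·M-spoke-rim : ∀ a b → (P · M) (a ↑ˡ k) (k ↑ʳ b) ≡ κ * X a b + κ * X a (shift b)
  P·M-spoke-rim a b = begin
    (P · M) (a ↑ˡ k) (k ↑ʳ b)
      ≡⟨ cong₂ _+_ (trans (cong (P (a ↑ˡ k) Fin.zero *_) (M-hub-rim b)) (ℚP.*-zeroʳ (P (a ↑ˡ k) Fin.zero)))
           (∑-cong k (λ i → trans (cong₂ _*_ (P-spoke-cycle a i) (M-cycle-rim i b))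
                                  (ℚP.*-comm (κ * X a i) (C i b)))) ⟩
    0ℚ + ∑ k (λ i → C i b * (κ * X a i))
      ≡⟨ trans (ℚP.+-identityˡ (∑ k (λ i → C i b * (κ * X a i)))) (∑-C-col b (λ i → κ * X a i)) ⟩
    κ * X a b + κ * X a (shift b)
      ∎
    where open ≡-Reasoning

  P·M-rim-spoke : ∀ b a → (P · M) (k ↑ʳ b) (a ↑ˡ k) ≡ κ * X b a + κ * X (shift b) a
  P·M-rim-spoke b a = begin
    (P · M) (k ↑ʳ b) (a ↑ˡ k)
      ≡⟨ cong₂ _+_ (cong₂ _*_ (P-rim-hub b) (M-hub-spoke a))
           (trans (∑-cong k (λ i → cong₂ _*_ (P-rim-cycle b i) (M-cycle-spoke i a)))
                  (∑-Idʳ k a (λ i → κ * Y b i))) ⟩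
    κ * - 1ℚ * 1ℚ + κ * Y b a
      ≡⟨ cong (λ y → κ * - 1ℚ * 1ℚ + κ * y) (Y≡J+X+Xshift b a) ⟩
    κ * - 1ℚ * 1ℚ + κ * (1ℚ + (X b a + X (shift b) a))
      ≡⟨ solve 3 (λ κ x y → κ :* (:- con 1ℚ) :* con 1ℚ :+ κ :* (con 1ℚ :+ (x :+ y)) := κ :* x :+ κ :* y)
           refl κ (X b a) (X (shift b) a) ⟩
    κ * X b a + κ * X (shift b) a
      ∎
    where open ≡-Reasoning

  P·M-rim-rim : ∀ b b′ → (P · M) (k ↑ʳ b) (k ↑ʳ b′) ≡
    κ * (ℕtoℚ 2 + ((X b b′ + X (shift b) (shift b′)) + (X (shift b) b′ + X b (shift b′))))
  P·M-rim-rim b b′ = begin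
    (P · M) (k ↑ʳ b) (k ↑ʳ b′)
      ≡⟨ cong₂ _+_ (trans (cong (P (k ↑ʳ b) Fin.zero *_) (M-hub-rim b′)) (ℚP.*-zeroʳ (P (k ↑ʳ b) Fin.zero)))
           (∑-cong k (λ i → trans (cong₂ _*_ (P-rim-cycle b i) (M-cycle-rim i b′))
                                  (ℚP.*-comm (κ * Y b i) (C i b′)))) ⟩
    0ℚ + ∑ k (λ i → C i b′ * (κ * Y b i))
      ≡⟨ trans (ℚP.+-identityˡ (∑ k (λ i → C i b′ * (κ * Y b i)))) (∑-C-col b′ (λ i → κ * Y b i)) ⟩
    κ * Y b b′ + κ * Y b (shift b′)
      ≡⟨ cong₂ (λ y y′ → κ * y + κ * y′) (Y≡J+X+Xshift b b′) (Y≡J+X+Xshift b (shift b′)) ⟩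
    κ * (1ℚ + (X b b′ + X (shift b) b′)) + κ * (1ℚ + (X b (shift b′) + X (shift b) (shift b′)))
      ≡⟨ solve 5 (λ κ p q r s → κ :* (con 1ℚ :+ (p :+ q)) :+ κ :* (con 1ℚ :+ (r :+ s))
                               := κ :* (con (ℕtoℚ 2) :+ ((p :+ s) :+ (q :+ r))))
           refl κ (X b b′) (X (shift b) b′) (X b (shift b′)) (X (shift b) (shift b′)) ⟩
    κ * (ℕtoℚ 2 + ((X b b′ + X (shift b) (shift b′)) + (X (shift b) b′ + X b (shift b′))))
      ∎
    where open ≡-Reasoning

  P·M-symmetric : Symmetric (P · M)
  P·M-symmetric r s with ↑-cases k k r | ↑-cases k k s
  ... | inj₁ (a , refl) | inj₁ (a′ , refl) = begin
    (P · M) (a′ ↑ˡ k) (a ↑ˡ k)        ≡⟨ P·M-spoke-spoke a′ a ⟩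
    κ * ℕtoℚ 2 + κ * X a′ a           ≡⟨ cong (λ x → κ * ℕtoℚ 2 + κ * x) (X-symmetric a a′) ⟩
    κ * ℕtoℚ 2 + κ * X a a′           ≡⟨ P·M-spoke-spoke a a′ ⟨
    (P · M) (a ↑ˡ k) (a′ ↑ˡ k)        ∎
    where open ≡-Reasoning
  ... | inj₁ (a , refl) | inj₂ (b , refl) = begin
    (P · M) (k ↑ʳ b) (a ↑ˡ k)         ≡⟨ P·M-rim-spoke b a ⟩
    κ * X b a + κ * X (shift b) a     ≡⟨ cong₂ (λ x y → κ * x + κ * y) (X-symmetric a b) (X-symmetric a (shift b)) ⟩
    κ * X a b + κ * X a (shift b)     ≡⟨ P·M-spoke-rim a b ⟨
    (P · M) (a ↑ˡ k) (k ↑ʳ b)         ∎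
    where open ≡-Reasoning
  ... | inj₂ (b , refl) | inj₁ (a , refl) = begin
    (P · M) (a ↑ˡ k) (k ↑ʳ b)         ≡⟨ P·M-spoke-rim a b ⟩
    κ * X a b + κ * X a (shift b)     ≡⟨ cong₂ (λ x y → κ * x + κ * y) (X-symmetric b a) (X-symmetric (shift b) a) ⟩
    κ * X b a + κ * X (shift b) a     ≡⟨ P·M-rim-spoke b a ⟨
    (P · M) (k ↑ʳ b) (a ↑ˡ k)         ∎
    where open ≡-Reasoning
  ... | inj₂ (b , refl) | inj₂ (b′ , refl) = begin
    (P · M) (k ↑ʳ b′) (k ↑ʳ b)
      ≡⟨ P·M-rim-rim b′ b ⟩
    κ * (ℕtoℚ 2 + ((X b′ b + X (shift b′) (shift b)) + (X (shift b′) b + X b′ (shift b))))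
      ≡⟨ cong₂ (λ x y → κ * (ℕtoℚ 2 + (x + y)))
           (cong₂ _+_ (X-symmetric b b′) (X-symmetric (shift b) (shift b′)))
           (trans (ℚP.+-comm (X (shift b′) b) (X b′ (shift b)))
                  (cong₂ _+_ (X-symmetric (shift b) b′) (X-symmetric b (shift b′)))) ⟩
    κ * (ℕtoℚ 2 + ((X b b′ + X (shift b) (shift b′)) + (X (shift b) b′ + X b (shift b′))))
      ≡⟨ P·M-rim-rim b b′ ⟨
    (P · M) (k ↑ʳ b) (k ↑ʳ b′)
      ∎
    where open ≡-Reasoning

  P-isMoorePenroseInverse : IsMoorePenroseInverse M P
  P-isMoorePenroseInverse = rightInverse⇒MoorePenrose M P M·P≋I P·M-symmetric

mainTheorem1 : (k : ℕ) → 3 ≤ k →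
    Σ (Matrix k k) (λ Inv →
      (((Cmat k · (Cmat k ᵀ)) ⊕ Id k) · Inv ≋ Id k) ×
      (Inv · ((Cmat k · (Cmat k ᵀ)) ⊕ Id k) ≋ Id k) ×
      IsMoorePenroseInverse (Mmat k) (Pmat k Inv))
mainTheorem1 (suc (suc (suc n))) (s≤s (s≤s (s≤s z≤n))) =
  Inv , CCᵀ+I·Inv≋I , Inv·CCᵀ+I≋I , P-isMoorePenroseInverse
  where
  open CirculantInverse (suc n)
  open PseudoInverse (suc (suc n)) (s≤s z≤n) Inv Inv-symmetric CCᵀ+I·Inv≋I
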